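{- Let $G$ be a zero-divisor graph with seven vertices, and let $x$ be a vertex of maximum degree $\Delta$. Then $\Delta=|N(x)|\ge 4$.
   Context: For a commutative semigroup $S$ with zero, its zero-divisor graph $\Gamma(S)$ has as vertices the nonzero zero-divisors of $S$, distinct $x,y$ being adjacent iff $xy=0$. A graph is a zero-divisor graph if it is isomorphic to $\Gamma(S)$ for some commutative semigroup $S$ with zero. $N(x)$ is the set of vertices adjacent to $x$. -}

module Defs where

open import Level using (0ℓ)
open import Data.Bool using (Bool; true)
open import Data.Nat using (ℕ; _≤_)
open import Data.Fin using (Fin)
open import Data.List using (length; filterᵇ; allFin)
open import Data.Product using (Σ; ∃; _×_; _,_)
open import Relation.Binary.PropositionalEquality using (_≡_)
open import Relation.Nullary using (¬_)
open import Algebra.Bundles using (CommutativeSemigroup)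
open import Function.Bundles using (_⇔_)

record CommSemigroupWithZero : Set₁ where
  field
    commSemigroup : CommutativeSemigroup 0ℓ 0ℓ
  open CommutativeSemigroup commSemigroup public
  field
    𝟘      : Carrier
    zeroˡ  : ∀ x → (𝟘 ∙ x) ≈ 𝟘
    zeroʳ  : ∀ x → (x ∙ 𝟘) ≈ 𝟘

module _ (S : CommSemigroupWithZero) where
  open CommSemigroupWithZero S

  IsNonzeroZeroDivisor : Carrier → Set
  IsNonzeroZeroDivisor x = ¬ (x ≈ 𝟘) × ∃ λ y → ¬ (y ≈ 𝟘) × (x ∙ y) ≈ 𝟘

Graph : ℕ → Set
Graph n = Fin n → Fin n → Bool

-- G ≅ Γ(S), witnessed by a bijection f from the vertices of G onto the
-- nonzero zero-divisors of S (modulo the setoid equality of S), such that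
-- i ~ j in G  iff  f i ≠ f j (distinct) and f i · f j = 0.
IsoToZeroDivisorGraph : ∀ {n} → Graph n → CommSemigroupWithZero → Set
IsoToZeroDivisorGraph {n} G S =
  Σ (Fin n → Carrier) λ f →
      (∀ i → IsNonzeroZeroDivisor S (f i))
    × (∀ i j → f i ≈ f j → i ≡ j)
    × (∀ z → IsNonzeroZeroDivisor S z → ∃ λ i → f i ≈ z)
    × (∀ i j → (G i j ≡ true) ⇔ (¬ (f i ≈ f j) × (f i ∙ f j) ≈ 𝟘))
  where open CommSemigroupWithZero S

IsZeroDivisorGraph : ∀ {n} → Graph n → Set₁
IsZeroDivisorGraph G = ∃ λ S → IsoToZeroDivisorGraph G S

degree : ∀ {n} → Graph n → Fin n → ℕ
degree G x = length (filterᵇ (G x) (allFin _))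

HasMaxDegree : ∀ {n} → Graph n → Fin n → Set
HasMaxDegree G x = ∀ y → degree G y ≤ degree G x

-- Suppose the maximum degree Δ = |N(x)| is at most 3, so at least three vertices lie outside N[x]
-- ("far" vertices).  For non-adjacent vertices a ≠ b the product ab is a vertex whose closed
-- neighbourhood contains N(a) ∪ N(b); comparing its degree with Δ shows first that every
-- neighbour of a far vertex lies in N(x), and then that a vertex of N(x) is adjacent to at most
-- one far vertex.  Take three far vertices u₁, u₂, u₃ with neighbours t₁, t₂, t₃ ∈ N(x): the tᵢ
-- are distinct, and the same product argument makes t₁ adjacent to t₂ and t₃, so t₁ has the
-- four neighbours x, u₁, t₂, t₃.
module Submission where

open import Defs
open import Data.Bool using (Bool; true; false)
open import Data.Nat using (ℕ; zero; suc; _+_; _∸_; _≤_; _<_; _≤?_; z≤n; s≤s)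
open import Data.Nat.Properties
  using (≤-refl; ≤-trans; ≤-reflexive; ≤⇒≯; ≮⇒≥; +-monoʳ-≤; +-suc; ∸-mono; ∸-monoʳ-≤; module ≤-Reasoning)
open import Data.Fin using (Fin; zero; suc; _≟_)
open import Data.Fin.Subset hiding (⊥)
open import Data.Fin.Subset.Properties
open import Data.List using (List; _∷_; length; filterᵇ)
import Data.List as List
open import Data.List.Relation.Unary.All as All using (All; []; _∷_)
open import Data.List.Relation.Unary.Unique.Propositional using (Unique; []; _∷_)
open import Data.Product using (∃; _×_; _,_; proj₁; proj₂)
open import Data.Sum using (_⊎_; inj₁; inj₂; [_,_]′)
open import Data.Empty using (⊥; ⊥-elim)
open import Data.Vec using ([]; _∷_; here; there; tabulate)
open import Data.Vec.Properties using ([]=⇒lookup; lookup⇒[]=; lookup∘tabulate)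
open import Function using (_∘_; id)
open import Function.Bundles using (_⇔_; mk⇔; Equivalence)
import Function.Properties.Equivalence as ⇔
import Relation.Binary.Reasoning.Setoid as ≈-Reasoning
open import Relation.Binary.PropositionalEquality
  using (_≡_; _≢_; refl; sym; trans; cong; subst; subst₂; ≢-sym)
open import Relation.Nullary using (¬_; yes; no)
open import Relation.Nullary.Decidable using (decidable-stable)

private
  variable
    n : ℕ
    p q : Subset n

∣p∪q∣≤∣p∣+∣q∣ : ∀ (p q : Subset n) → ∣ p ∪ q ∣ ≤ ∣ p ∣ + ∣ q ∣
∣p∪q∣≤∣p∣+∣q∣ []            []            = z≤n
∣p∪q∣≤∣p∣+∣q∣ (inside  ∷ p) (s       ∷ q) =
  s≤s (≤-trans (∣p∪q∣≤∣p∣+∣q∣ p q) (+-monoʳ-≤ ∣ p ∣ (∣p∣≤∣x∷p∣ s q)))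
∣p∪q∣≤∣p∣+∣q∣ (outside ∷ p) (inside  ∷ q) =
  ≤-trans (s≤s (∣p∪q∣≤∣p∣+∣q∣ p q)) (≤-reflexive (sym (+-suc ∣ p ∣ ∣ q ∣)))
∣p∪q∣≤∣p∣+∣q∣ (outside ∷ p) (outside ∷ q) = ∣p∪q∣≤∣p∣+∣q∣ p q

∣⁅x⁆∪p∣≤1+∣p∣ : ∀ (x : Fin n) p → ∣ ⁅ x ⁆ ∪ p ∣ ≤ suc ∣ p ∣
∣⁅x⁆∪p∣≤1+∣p∣ x p = begin
  ∣ ⁅ x ⁆ ∪ p ∣       ≤⟨ ∣p∪q∣≤∣p∣+∣q∣ ⁅ x ⁆ p ⟩
  ∣ ⁅ x ⁆ ∣ + ∣ p ∣   ≡⟨ cong (_+ ∣ p ∣) (∣⁅x⁆∣≡1 x) ⟩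
  suc ∣ p ∣           ∎
  where open ≤-Reasoning

private
  there-∉ : ∀ {s t} → (∃ λ x → x ∈ q × x ∉ p) → ∃ λ x → x ∈ t ∷ q × x ∉ s ∷ p
  there-∉ (x , x∈q , x∉p) = suc x , there x∈q , x∉p ∘ drop-there

∣p∣<∣q∣⇒∃x∈q∉p : ∀ (p q : Subset n) → ∣ p ∣ < ∣ q ∣ → ∃ λ x → x ∈ q × x ∉ p
∣p∣<∣q∣⇒∃x∈q∉p (s       ∷ p) (outside ∷ q) ∣s∷p∣<∣q∣ =
  there-∉ (∣p∣<∣q∣⇒∃x∈q∉p p q (≤-trans (s≤s (∣p∣≤∣x∷p∣ s p)) ∣s∷p∣<∣q∣))
∣p∣<∣q∣⇒∃x∈q∉p (outside ∷ p) (inside  ∷ q) _               = zero , here , λ ()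
∣p∣<∣q∣⇒∃x∈q∉p (inside  ∷ p) (inside  ∷ q) (s≤s ∣p∣<∣q∣)   =
  there-∉ (∣p∣<∣q∣⇒∃x∈q∉p p q ∣p∣<∣q∣)

Unique⇒length≤∣p∣ : ∀ {xs : List (Fin n)} → Unique xs → All (_∈ p) xs → length xs ≤ ∣ p ∣
Unique⇒length≤∣p∣ []             []           = z≤n
Unique⇒length≤∣p∣ {p = p} {xs = x ∷ _} (x≢xs ∷ uniq) (x∈p ∷ xs⊆p) =
  ≤-trans (s≤s (Unique⇒length≤∣p∣ uniq (All.zipWith ∈p-x (xs⊆p , x≢xs)))) (x∈p⇒∣p-x∣<∣p∣ x∈p)
  where
  ∈p-x : ∀ {y} → y ∈ p × x ≢ y → y ∈ p - x
  ∈p-x (y∈p , x≢y) = x∈p∧x≢y⇒x∈p-y y∈p (≢-sym x≢y)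

∣p∣<∣q∣-by-exchange : ∀ {a b d : Fin n} → (∀ {k} → k ∈ p → k ≢ a → k ∈ q) →
                      b ∈ q → d ∈ q → b ∉ p → d ∉ p → b ≢ d → ∣ p ∣ < ∣ q ∣
∣p∣<∣q∣-by-exchange {p = p} {q = q} {a} {b} {d} p-a⊆q b∈q d∈q b∉p d∉p b≢d = begin-strict
  ∣ p ∣                 ≤⟨ p⊆q⇒∣p∣≤∣q∣ p⊆⁅a⁆∪[q-b-d] ⟩
  ∣ ⁅ a ⁆ ∪ (q - b - d) ∣ ≤⟨ ∣⁅x⁆∪p∣≤1+∣p∣ a (q - b - d) ⟩
  suc ∣ q - b - d ∣     ≤⟨ x∈p⇒∣p-x∣<∣p∣ (x∈p∧x≢y⇒x∈p-y d∈q (≢-sym b≢d)) ⟩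
  ∣ q - b ∣             <⟨ x∈p⇒∣p-x∣<∣p∣ b∈q ⟩
  ∣ q ∣                 ∎
  where
  open ≤-Reasoning
  p⊆⁅a⁆∪[q-b-d] : p ⊆ ⁅ a ⁆ ∪ (q - b - d)
  p⊆⁅a⁆∪[q-b-d] {k} k∈p with k ≟ a
  ... | yes refl = x∈p∪q⁺ (inj₁ (x∈⁅x⁆ k))
  ... | no  k≢a  = x∈p∪q⁺ (inj₂ (x∈p∧x≢y⇒x∈p-y (x∈p∧x≢y⇒x∈p-y (p-a⊆q k∈p k≢a)
                     λ { refl → b∉p k∈p }) λ { refl → d∉p k∈p }))

module Adjacency {n} (N : Fin n → Subset n) where

  infix 4 _~_ _∈N[_]

  _~_ : Fin n → Fin n → Set
  i ~ j = j ∈ N i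

  _∈N[_] : Fin n → Fin n → Set
  k ∈N[ c ] = k ≡ c ⊎ c ~ k

-- For non-adjacent i ≠ j of Γ(S), the product ij is such a vertex c.
record ZeroDivisorGraphLaws {n} (N : Fin n → Subset n) : Set where
  open Adjacency N
  field
    ~-sym         : ∀ {i j} → i ~ j → j ~ i
    ~-irrefl      : ∀ {i} → ¬ i ~ i
    nonisolated   : ∀ {i j} → i ≢ j → ∃ (i ~_)
    productVertex : ∀ {i j} → i ≢ j → ¬ i ~ j → ∃ λ c → ∀ {k} → i ~ k ⊎ j ~ k → k ∈N[ c ]

module ZeroDivisorGraphLaws-Properties {n} {N : Fin n → Subset n} (laws : ZeroDivisorGraphLaws N) where
  open Adjacency N
  open ZeroDivisorGraphLaws laws

  ~⇒≢ : ∀ {i j} → i ~ j → i ≢ j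
  ~⇒≢ i~j refl = ~-irrefl i~j

  ∈N[]⇒~ : ∀ {c k} → k ∈N[ c ] → k ≢ c → c ~ k
  ∈N[]⇒~ (inj₁ k≡c) k≢c = ⊥-elim (k≢c k≡c)
  ∈N[]⇒~ (inj₂ c~k) _   = c~k

  module _ {x : Fin n} (maximal : ∀ y → ∣ N y ∣ ≤ ∣ N x ∣) where

    ∣Nx∣≮∣Ny∣ : ∀ y → ¬ ∣ N x ∣ < ∣ N y ∣
    ∣Nx∣≮∣Ny∣ y = ≤⇒≯ (maximal y)

    Far : Fin n → Set
    Far u = u ≢ x × ¬ x ~ u

    far≢near : ∀ {u t} → Far u → x ~ t → u ≢ t
    far≢near (_ , x≁u) x~t refl = x≁u x~t

    far-neighbours-near : ∀ {u w} → Far u → u ~ w → x ~ w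
    far-neighbours-near {u} {w} (u≢x , x≁u) u~w = decidable-stable (w ∈? N x) x≁w⇒⊥
      where
      x≢w : x ≢ w
      x≢w refl = x≁u (~-sym u~w)

      x≁w⇒⊥ : ¬ ¬ x ~ w
      x≁w⇒⊥ x≁w with productVertex (≢-sym u≢x) x≁u
      ... | c , covers with covers (inj₂ u~w)
      ... | inj₁ refl = ∣Nx∣≮∣Ny∣ w (p⊂q⇒∣p∣<∣q∣ (Nx⊆Nw , u , ~-sym u~w , x≁u))
        where
        Nx⊆Nw : N x ⊆ N w
        Nx⊆Nw x~k = ∈N[]⇒~ (covers (inj₁ x~k)) λ { refl → x≁w x~k }
      ... | inj₂ c~w with c ∈? N x
      -- N(c) ⊇ (N(x) ∖ {c}) ∪ {x, w}
      ... | yes x~c = ∣Nx∣≮∣Ny∣ c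
            (∣p∣<∣q∣-by-exchange (λ x~k → ∈N[]⇒~ (covers (inj₁ x~k))) (~-sym x~c) c~w ~-irrefl x≁w x≢w)
      ... | no  x≁c = ∣Nx∣≮∣Ny∣ c (p⊂q⇒∣p∣<∣q∣ (Nx⊆Nc , w , c~w , x≁w))
        where
        Nx⊆Nc : N x ⊆ N c
        Nx⊆Nc x~k = ∈N[]⇒~ (covers (inj₁ x~k)) λ { refl → x≁c x~k }

    dominator-adjacent : ∀ {a u c} → x ~ a → Far u → a ~ u → (∀ {k} → a ~ k → k ∈N[ c ]) → c ~ x × c ~ u
    dominator-adjacent x~a (u≢x , x≁u) a~u covers with covers (~-sym x~a)
    ... | inj₁ refl = ⊥-elim (x≁u (∈N[]⇒~ (covers a~u) u≢x))
    ... | inj₂ c~x  = c~x , ∈N[]⇒~ (covers a~u) λ { refl → x≁u (~-sym c~x) }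

    module _ (Δ≤3 : ∣ N x ∣ ≤ 3) (7≤n : 7 ≤ n) where

      ¬four-neighbours : ∀ {y a b c d} → a ≢ b → a ≢ c → a ≢ d → b ≢ c → b ≢ d → c ≢ d →
                         y ~ a → y ~ b → y ~ c → y ~ d → ⊥
      ¬four-neighbours {y} a≢b a≢c a≢d b≢c b≢d c≢d y~a y~b y~c y~d = ≤⇒≯ (≤-trans (maximal y) Δ≤3)
        (Unique⇒length≤∣p∣ ((a≢b ∷ a≢c ∷ a≢d ∷ []) ∷ (b≢c ∷ b≢d ∷ []) ∷ (c≢d ∷ []) ∷ [] ∷ [])
                           (y~a ∷ y~b ∷ y~c ∷ y~d ∷ []))

      R : Subset n
      R = ∁ (⁅ x ⁆ ∪ N x)

      ∈R⇒Far : ∀ {u} → u ∈ R → Far u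
      ∈R⇒Far {u} u∈R = x∉⁅y⁆⇒x≢y (u∉ ∘ inj₁) , u∉ ∘ inj₂
        where
        u∉ : ¬ (u ∈ ⁅ x ⁆ ⊎ u ∈ N x)
        u∉ = x∈∁p⇒x∉p u∈R ∘ x∈p∪q⁺

      3≤∣R∣ : 3 ≤ ∣ R ∣
      3≤∣R∣ = begin
        3                   ≡⟨⟩
        7 ∸ 4               ≤⟨ ∸-mono 7≤n (s≤s Δ≤3) ⟩
        n ∸ suc ∣ N x ∣     ≤⟨ ∸-monoʳ-≤ n (∣⁅x⁆∪p∣≤1+∣p∣ x (N x)) ⟩
        n ∸ ∣ ⁅ x ⁆ ∪ N x ∣ ≡⟨ ∣∁p∣≡n∸∣p∣ (⁅ x ⁆ ∪ N x) ⟨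
        ∣ R ∣               ∎
        where open ≤-Reasoning

      another-far : ∀ u v → ∃ λ w → Far w × w ≢ u × w ≢ v
      another-far u v with ∣p∣<∣q∣⇒∃x∈q∉p (⁅ u ⁆ ∪ ⁅ v ⁆) R (≤-trans (s≤s ∣⁅u⁆∪⁅v⁆∣≤2) 3≤∣R∣)
        where
        ∣⁅u⁆∪⁅v⁆∣≤2 : ∣ ⁅ u ⁆ ∪ ⁅ v ⁆ ∣ ≤ 2
        ∣⁅u⁆∪⁅v⁆∣≤2 = ≤-trans (∣⁅x⁆∪p∣≤1+∣p∣ u ⁅ v ⁆) (≤-reflexive (cong suc (∣⁅x⁆∣≡1 v)))
      ... | w , w∈R , w∉ = w , ∈R⇒Far w∈R , x∉⁅y⁆⇒x≢y (w∉ ∘ x∈p∪q⁺ ∘ inj₁) , x∉⁅y⁆⇒x≢y (w∉ ∘ x∈p∪q⁺ ∘ inj₂)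

      far-neighbour-unique : ∀ {a u u'} → Far u → Far u' → a ~ u → a ~ u' → u ≡ u'
      far-neighbour-unique {a} {u} {u'} fu@(u≢x , x≁u) fu'@(u'≢x , x≁u') a~u a~u' =
        decidable-stable (u ≟ u') u≢u'⇒⊥
        where
        x~a : x ~ a
        x~a = far-neighbours-near fu (~-sym a~u)

        u≢u'⇒⊥ : ¬ u ≢ u'
        u≢u'⇒⊥ u≢u' with another-far u u'
        ... | v , fv@(v≢x , x≁v) , v≢u , v≢u' with v ∈? N a
        ... | yes a~v = ¬four-neighbours (≢-sym u≢x) (≢-sym u'≢x) (≢-sym v≢x) u≢u' (≢-sym v≢u) (≢-sym v≢u')
                          (~-sym x~a) a~u a~u' a~v
        ... | no  a≁v with productVertex (λ { refl → x≁v x~a }) a≁v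
        ... | c , covers
            with dominator-adjacent x~a fu  a~u  (λ a~k → covers (inj₁ a~k))
               | dominator-adjacent x~a fu' a~u' (λ a~k → covers (inj₁ a~k))
               | nonisolated v≢x
        ... | c~x , c~u | _ , c~u' | t , v~t with covers (inj₂ v~t)
        ... | inj₁ refl = ¬four-neighbours (≢-sym u≢x) (≢-sym u'≢x) (≢-sym v≢x) u≢u' (≢-sym v≢u) (≢-sym v≢u')
                            c~x c~u c~u' (~-sym v~t)
        ... | inj₂ c~t  = ¬four-neighbours (≢-sym u≢x) (≢-sym u'≢x) (~⇒≢ x~t) u≢u' (far≢near fu x~t)
                            (far≢near fu' x~t) c~x c~u c~u' c~t
          where
          x~t : x ~ t
          x~t = far-neighbours-near fv v~t

      far-neighbours-distinct : ∀ {u u' t t'} → Far u → Far u' → u ≢ u' → u ~ t → u' ~ t' → t ≢ t'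
      far-neighbours-distinct fu fu' u≢u' u~t u'~t' refl =
        u≢u' (far-neighbour-unique fu fu' (~-sym u~t) (~-sym u'~t'))

      near-neighbours-adjacent : ∀ {u₁ u₂ u₃ t₁ t₂ t₃} → Far u₁ → Far u₂ → Far u₃ →
                                 u₁ ≢ u₂ → u₁ ≢ u₃ → u₂ ≢ u₃ → u₁ ~ t₁ → u₂ ~ t₂ → u₃ ~ t₃ → t₁ ~ t₂
      near-neighbours-adjacent {u₂ = u₂} {t₁ = t₁} {t₃ = t₃} f₁ f₂ f₃ u₁≢u₂ u₁≢u₃ u₂≢u₃ u₁~t₁ u₂~t₂ u₃~t₃
        with u₂ ∈? N t₁
      ... | yes t₁~u₂ = ⊥-elim (u₁≢u₂ (far-neighbour-unique f₁ f₂ (~-sym u₁~t₁) t₁~u₂))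
      ... | no  t₁≁u₂ with productVertex (far≢near f₂ (far-neighbours-near f₁ u₁~t₁) ∘ sym) t₁≁u₂
      ... | d , covers
          with dominator-adjacent (far-neighbours-near f₁ u₁~t₁) f₁ (~-sym u₁~t₁) (λ t₁~k → covers (inj₁ t₁~k))
             | covers (inj₂ u₂~t₂)
      ... | _ , d~u₁ | inj₁ refl =
            ⊥-elim (u₁≢u₂ (far-neighbour-unique f₁ f₂ d~u₁ (~-sym u₂~t₂)))
      ... | d~x , d~u₁ | inj₂ d~t₂ with d ≟ t₁ | d ≟ t₃
      ... | yes refl | _        = d~t₂
      ... | no _     | yes refl =
            ⊥-elim (u₁≢u₃ (far-neighbour-unique f₁ f₃ d~u₁ (~-sym u₃~t₃)))
      ... | no d≢t₁  | no d≢t₃  =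
            ⊥-elim (¬four-neighbours (far-neighbours-distinct f₁ f₂ u₁≢u₂ u₁~t₁ u₂~t₂)
                      (far-neighbours-distinct f₁ f₃ u₁≢u₃ u₁~t₁ u₃~t₃) (≢-sym d≢t₁)
                      (far-neighbours-distinct f₂ f₃ u₂≢u₃ u₂~t₂ u₃~t₃) (≢-sym (~⇒≢ d~t₂)) (≢-sym d≢t₃)
                      (far-neighbours-near f₁ u₁~t₁) (far-neighbours-near f₂ u₂~t₂)
                      (far-neighbours-near f₃ u₃~t₃) (~-sym d~x))

      maxDegree≤3⇒⊥ : ⊥
      maxDegree≤3⇒⊥ with another-far x x
      ... | u₁ , f₁ , _ with another-far u₁ u₁
      ... | u₂ , f₂ , u₂≢u₁ , _ with another-far u₁ u₂
      ... | u₃ , f₃ , u₃≢u₁ , u₃≢u₂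
          with nonisolated (proj₁ f₁) | nonisolated (proj₁ f₂) | nonisolated (proj₁ f₃)
      ... | t₁ , u₁~t₁ | t₂ , u₂~t₂ | t₃ , u₃~t₃ =
        ¬four-neighbours (≢-sym (proj₁ f₁)) (~⇒≢ x~t₂) (~⇒≢ x~t₃) (far≢near f₁ x~t₂) (far≢near f₁ x~t₃)
          (far-neighbours-distinct f₂ f₃ u₂≢u₃ u₂~t₂ u₃~t₃)
          (~-sym (far-neighbours-near f₁ u₁~t₁)) (~-sym u₁~t₁)
          (near-neighbours-adjacent f₁ f₂ f₃ u₁≢u₂ u₁≢u₃ u₂≢u₃ u₁~t₁ u₂~t₂ u₃~t₃)
          (near-neighbours-adjacent f₁ f₃ f₂ u₁≢u₃ u₁≢u₂ (≢-sym u₂≢u₃) u₁~t₁ u₃~t₃ u₂~t₂)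
        where
        u₁≢u₂ : u₁ ≢ u₂
        u₁≢u₂ = ≢-sym u₂≢u₁
        u₁≢u₃ : u₁ ≢ u₃
        u₁≢u₃ = ≢-sym u₃≢u₁
        u₂≢u₃ : u₂ ≢ u₃
        u₂≢u₃ = ≢-sym u₃≢u₂
        x~t₂ : x ~ t₂
        x~t₂ = far-neighbours-near f₂ u₂~t₂
        x~t₃ : x ~ t₃
        x~t₃ = far-neighbours-near f₃ u₃~t₃

maxDegree≥4 : ∀ {n} {N : Fin n → Subset n} → 7 ≤ n → ZeroDivisorGraphLaws N →
              ∀ {x} → (∀ y → ∣ N y ∣ ≤ ∣ N x ∣) → 4 ≤ ∣ N x ∣
maxDegree≥4 7≤n laws maximal = decidable-stable (4 ≤? _) λ 4≰∣Nx∣ → maxDegree≤3⇒⊥ maximal (≮⇒≥ 4≰∣Nx∣) 7≤n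
  where open ZeroDivisorGraphLaws-Properties laws

module _ (S : CommSemigroupWithZero) where
  open CommSemigroupWithZero S
    using (_≈_; _∙_; 𝟘; setoid; comm; assoc; ∙-congˡ; ∙-congʳ; zeroˡ; zeroʳ)
    renaming (trans to ≈-trans)
  open ≈-Reasoning setoid

  annihilator-∙ˡ : ∀ {a b k} → a ∙ k ≈ 𝟘 → (a ∙ b) ∙ k ≈ 𝟘
  annihilator-∙ˡ {a} {b} {k} ak≈𝟘 = begin
    (a ∙ b) ∙ k ≈⟨ assoc a b k ⟩
    a ∙ (b ∙ k) ≈⟨ ∙-congˡ (comm b k) ⟩
    a ∙ (k ∙ b) ≈⟨ assoc a k b ⟨
    (a ∙ k) ∙ b ≈⟨ ∙-congʳ ak≈𝟘 ⟩
    𝟘 ∙ b       ≈⟨ zeroˡ b ⟩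
    𝟘           ∎

  annihilator-∙ʳ : ∀ {a b k} → b ∙ k ≈ 𝟘 → (a ∙ b) ∙ k ≈ 𝟘
  annihilator-∙ʳ {a} {b} {k} bk≈𝟘 = begin
    (a ∙ b) ∙ k ≈⟨ assoc a b k ⟩
    a ∙ (b ∙ k) ≈⟨ ∙-congˡ bk≈𝟘 ⟩
    a ∙ 𝟘       ≈⟨ zeroʳ a ⟩
    𝟘           ∎

  product-isNonzeroZeroDivisor : ∀ {a b} → IsNonzeroZeroDivisor S a → ¬ (a ∙ b) ≈ 𝟘 →
                                 IsNonzeroZeroDivisor S (a ∙ b)
  product-isNonzeroZeroDivisor (_ , y , y≉𝟘 , ay≈𝟘) ab≉𝟘 = ab≉𝟘 , y , y≉𝟘 , annihilator-∙ˡ ay≈𝟘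

  annihilator-isNonzeroZeroDivisor : ∀ {a y} → ¬ a ≈ 𝟘 → ¬ y ≈ 𝟘 → a ∙ y ≈ 𝟘 → IsNonzeroZeroDivisor S y
  annihilator-isNonzeroZeroDivisor a≉𝟘 y≉𝟘 ay≈𝟘 = y≉𝟘 , _ , a≉𝟘 , ≈-trans (comm _ _) ay≈𝟘

neighbourhood : ∀ {n} → Graph n → Fin n → Subset n
neighbourhood G i = tabulate (G i)

∈neighbourhood⇔ : ∀ {n} {G : Graph n} {i j} → j ∈ neighbourhood G i ⇔ G i j ≡ true
∈neighbourhood⇔ {G = G} {i} {j} = mk⇔
  (λ j∈Ni → trans (sym (lookup∘tabulate (G i) j)) ([]=⇒lookup j∈Ni))
  (λ Gij → lookup⇒[]= j _ (trans (lookup∘tabulate (G i) j) Gij))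

module _ {n} {G : Graph n} {S : CommSemigroupWithZero} (iso : IsoToZeroDivisorGraph G S) where
  open CommSemigroupWithZero S
    using (Carrier; _≈_; _∙_; 𝟘; setoid; comm; ∙-congˡ; ∙-congʳ)
    renaming (refl to ≈-refl; sym to ≈-sym; trans to ≈-trans)
  open ≈-Reasoning setoid
  open Adjacency (neighbourhood G)

  private
    vertex : Fin n → Carrier
    vertex = proj₁ iso

    vertex-isNonzeroZeroDivisor : ∀ i → IsNonzeroZeroDivisor S (vertex i)
    vertex-isNonzeroZeroDivisor = proj₁ (proj₂ iso)

    vertex-injective : ∀ i j → vertex i ≈ vertex j → i ≡ j
    vertex-injective = proj₁ (proj₂ (proj₂ iso))

    vertex-surjective : ∀ z → IsNonzeroZeroDivisor S z → ∃ λ i → vertex i ≈ z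
    vertex-surjective = proj₁ (proj₂ (proj₂ (proj₂ iso)))

    ~⇔ : ∀ i j → i ~ j ⇔ (¬ vertex i ≈ vertex j × vertex i ∙ vertex j ≈ 𝟘)
    ~⇔ i j = ⇔.trans (∈neighbourhood⇔ {G = G}) (proj₂ (proj₂ (proj₂ (proj₂ iso))) i j)

  ~⇒≉ : ∀ {i j} → i ~ j → ¬ vertex i ≈ vertex j
  ~⇒≉ = proj₁ ∘ Equivalence.to (~⇔ _ _)

  ~⇒∙≈𝟘 : ∀ {i j} → i ~ j → vertex i ∙ vertex j ≈ 𝟘
  ~⇒∙≈𝟘 = proj₂ ∘ Equivalence.to (~⇔ _ _)

  ∙≈𝟘⇒~ : ∀ {i j} → i ≢ j → vertex i ∙ vertex j ≈ 𝟘 → i ~ j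
  ∙≈𝟘⇒~ i≢j ij≈𝟘 = Equivalence.from (~⇔ _ _) (i≢j ∘ vertex-injective _ _ , ij≈𝟘)

  ∙≈𝟘⇒∈N[] : ∀ {c k} → vertex c ∙ vertex k ≈ 𝟘 → k ∈N[ c ]
  ∙≈𝟘⇒∈N[] {c} {k} ck≈𝟘 with k ≟ c
  ... | yes k≡c = inj₁ k≡c
  ... | no  k≢c = inj₂ (∙≈𝟘⇒~ (≢-sym k≢c) ck≈𝟘)

  annihilator-neighbour : ∀ i {y} → ¬ y ≈ 𝟘 → vertex i ∙ y ≈ 𝟘 → ∃ (i ~_) ⊎ y ≈ vertex i
  annihilator-neighbour i y≉𝟘 iy≈𝟘
    with vertex-surjective _
           (annihilator-isNonzeroZeroDivisor S (proj₁ (vertex-isNonzeroZeroDivisor i)) y≉𝟘 iy≈𝟘)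
  ... | j , j≈y with j ≟ i
  ... | yes refl = inj₂ (≈-sym j≈y)
  ... | no  j≢i  = inj₁ (j , ∙≈𝟘⇒~ (≢-sym j≢i) (≈-trans (∙-congˡ j≈y) iy≈𝟘))

  square-zero-neighbour : ∀ {i k} → vertex i ∙ vertex i ≈ 𝟘 → ¬ vertex i ∙ vertex k ≈ 𝟘 → ∃ (i ~_)
  square-zero-neighbour {i} {k} ii≈𝟘 ik≉𝟘
    with annihilator-neighbour i ik≉𝟘 (≈-trans (comm _ _) (annihilator-∙ˡ S ii≈𝟘))
  ... | inj₁ i~j  = i~j
  ... | inj₂ ik≈i with proj₂ (vertex-isNonzeroZeroDivisor k)
  ... | z , z≉𝟘 , kz≈𝟘
      with annihilator-neighbour i z≉𝟘 (≈-trans (∙-congʳ (≈-sym ik≈i)) (annihilator-∙ʳ S kz≈𝟘))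
  ... | inj₁ i~j = i~j
  ... | inj₂ z≈i = ⊥-elim (ik≉𝟘 (begin
    vertex i ∙ vertex k ≈⟨ comm _ _ ⟩
    vertex k ∙ vertex i ≈⟨ ∙-congˡ z≈i ⟨
    vertex k ∙ z        ≈⟨ kz≈𝟘 ⟩
    𝟘                   ∎))

  zeroDivisorGraphLaws : ZeroDivisorGraphLaws (neighbourhood G)
  zeroDivisorGraphLaws = record
    { ~-sym         = λ i~j → ∙≈𝟘⇒~ (λ { refl → ~⇒≉ i~j ≈-refl }) (≈-trans (comm _ _) (~⇒∙≈𝟘 i~j))
    ; ~-irrefl      = λ i~i → ~⇒≉ i~i ≈-refl
    ; nonisolated   = nonisolated
    ; productVertex = productVertex
    }
    where
    nonisolated : ∀ {i k} → i ≢ k → ∃ (i ~_)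
    nonisolated {i} {k} i≢k with proj₂ (vertex-isNonzeroZeroDivisor i)
    ... | y , y≉𝟘 , iy≈𝟘 with annihilator-neighbour i y≉𝟘 iy≈𝟘 | k ∈? neighbourhood G i
    ... | inj₁ i~j | _       = i~j
    ... | inj₂ _   | yes i~k = k , i~k
    ... | inj₂ y≈i | no  i≁k = square-zero-neighbour (≈-trans (∙-congˡ (≈-sym y≈i)) iy≈𝟘) (i≁k ∘ ∙≈𝟘⇒~ i≢k)

    productVertex : ∀ {i j} → i ≢ j → ¬ i ~ j → ∃ λ c → ∀ {k} → i ~ k ⊎ j ~ k → k ∈N[ c ]
    productVertex {i} {j} i≢j i≁j
      with vertex-surjective _
             (product-isNonzeroZeroDivisor S (vertex-isNonzeroZeroDivisor i) (i≁j ∘ ∙≈𝟘⇒~ i≢j))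
    ... | c , c≈ij = c , λ i~k⊎j~k → ∙≈𝟘⇒∈N[] (≈-trans (∙-congʳ c≈ij)
                      ([ annihilator-∙ˡ S ∘ ~⇒∙≈𝟘 , annihilator-∙ʳ S ∘ ~⇒∙≈𝟘 ]′ i~k⊎j~k))

length-filterᵇ-tabulate : ∀ {a} {A : Set a} {n} (g : A → Bool) (h : Fin n → A) →
                          length (filterᵇ g (List.tabulate h)) ≡ ∣ tabulate (g ∘ h) ∣
length-filterᵇ-tabulate {n = zero}  g h = refl
length-filterᵇ-tabulate {n = suc n} g h with g (h zero)
... | true  = cong suc (length-filterᵇ-tabulate g (h ∘ suc))
... | false = length-filterᵇ-tabulate g (h ∘ suc)

degree≡∣neighbourhood∣ : ∀ {n} (G : Graph n) x → degree G x ≡ ∣ neighbourhood G x ∣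
degree≡∣neighbourhood∣ G x = length-filterᵇ-tabulate (G x) id

mainTheorem7 : (G : Graph 7) → IsZeroDivisorGraph G → (x : Fin 7) → HasMaxDegree G x → 4 ≤ degree G x
mainTheorem7 G (S , iso) x maximal =
  subst (4 ≤_) (sym (degree≡ x)) (maxDegree≥4 ≤-refl (zeroDivisorGraphLaws {S = S} iso) maximal′)
  where
  degree≡ : ∀ y → degree G y ≡ ∣ neighbourhood G y ∣
  degree≡ = degree≡∣neighbourhood∣ G
  maximal′ : ∀ y → ∣ neighbourhood G y ∣ ≤ ∣ neighbourhood G x ∣
  maximal′ y = subst₂ _≤_ (degree≡ y) (degree≡ x) (maximal y)
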